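{- Let $n = p_1^{k_1} p_2^{k_2} \cdots p_r^{k_r}$ be the prime factorization of a positive integer $n$, with distinct primes $p_i$ and integers $k_i \ge 1$, and let $D = \prod_{i=1}^r (k_i+1)$ be the number of divisors of $n$. Assume $n$ is not prime and $D \ge 3$. Then the Eccentric Connectivity index of the divisor prime graph $G_{Dp(n)}$ is $$\xi^c(G_{Dp(n)}) = 2\prod_{i=1}^r (2k_i+1) - D - 1.$$
   Context: For a positive integer $n$, the divisor prime graph $G_{Dp(n)}$ is the simple graph whose vertex set is the set of positive divisors of $n$, in which two distinct vertices $x, y$ are adjacent if and only if $\gcd(x,y) = 1$ (no loops). For a connected graph $G$ with degree function $d(\cdot)$ and shortest-path distance $d(u,v)$, the eccentricity of $v$ is $\varepsilon(v) = \max_{u \in V(G)} d(v,u)$, and the Eccentric Connectivity index is $\xi^c(G) = \sum_{v \in V(G)} d(v)\varepsilon(v)$. -}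

module Defs where

open import Data.Bool using (Bool; true; false; if_then_else_; _∧_; not)
open import Data.Nat using (ℕ; zero; suc; _+_; _*_; _⊔_; _^_)
open import Data.Nat.Divisibility using (_∣?_)
open import Data.Nat.GCD using (gcd)
open import Data.Nat.Properties using (_≟_)
open import Data.List using (List; []; _∷_; map; upTo; length; filterᵇ; foldr)
open import Data.Bool.ListAction using (any)
open import Data.Nat.ListAction using (sum)
open import Data.Product using (_×_; _,_; proj₁; proj₂)
open import Relation.Nullary using (does)

divisors : ℕ → List ℕ
divisors n = filterᵇ (λ d → does (d ∣? n)) (map suc (upTo n))

adj : ℕ → ℕ → Bool
adj x y = not (does (x ≟ y)) ∧ does (gcd x y ≟ 1)

deg : ℕ → ℕ → ℕ
deg n v = length (filterᵇ (adj v) (divisors n))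

walk : ℕ → ℕ → ℕ → ℕ → Bool
walk n zero    u v = does (u ≟ v)
walk n (suc k) u v = any (λ w → adj u w ∧ walk n k w v) (divisors n)

-- A shortest path has fewer than |V| edges, so we search k = 0 .. |V|-1;
-- if nothing is found (disconnected case, not relevant here) we return |V|.
dist : ℕ → ℕ → ℕ → ℕ
dist n u v = go (length (divisors n)) 0
  where
  go : ℕ → ℕ → ℕ
  go zero    k = k
  go (suc f) k = if walk n k u v then k else go f (suc k)

ecc : ℕ → ℕ → ℕ
ecc n v = foldr _⊔_ 0 (map (dist n v) (divisors n))

ξc : ℕ → ℕ
ξc n = sum (map (λ v → deg n v * ecc n v) (divisors n))

factorValue : List (ℕ × ℕ) → ℕ
factorValue fs = foldr (λ pk r → proj₁ pk ^ proj₂ pk * r) 1 fs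

divisorCount : List (ℕ × ℕ) → ℕ
divisorCount fs = foldr (λ pk r → suc (proj₂ pk) * r) 1 fs

prodTwoKPlusOne : List (ℕ × ℕ) → ℕ
prodTwoKPlusOne fs = foldr (λ pk r → suc (2 * proj₂ pk) * r) 1 fs

{-# OPTIONS --safe #-}
module Submission where

-- The vertex 1 is adjacent to every other divisor, so all distances are at most 2, the
-- eccentricity of 1 is 1, and every other divisor v has eccentricity 2: if v ≠ n it is not adjacent
-- to n, and n is not adjacent to a third divisor, which exists because D ≥ 3.  For v ≠ 1 the degree of
-- v is the number c(v) of divisors coprime to v, while c(1) = D, so
--   ξ = (D − 1) + 2 Σ_{v ≠ 1} c(v) = 2 P − D − 1,   where P = Σ_v c(v).
-- P counts ordered coprime pairs of divisors.  The divisors of a coprime product a b are the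
-- products d e of divisors of a and of b, and d e ⊥ d' e' iff d ⊥ d' and e ⊥ e'; so P is
-- multiplicative, as is D, and P (p ^ k) = 2 k + 1 (the pairs (1 , p ^ j) and (p ^ i , 1)),
-- D (p ^ k) = k + 1.

open import Defs
open import Data.Bool using (Bool; true; false; if_then_else_; _∧_; _∨_; not; T; T?)
open import Data.Bool.ListAction using (any)
open import Data.Bool.Properties using (∧-zeroʳ; ∨-zeroʳ; T-≡)
open import Data.Nat
  using (ℕ; zero; suc; _+_; _*_; _∸_; _^_; _⊔_; _≤_; _<_; s≤s; s≤s⁻¹; z≤n; NonZero; >-nonZero; ≢-nonZero⁻¹;
         nonTrivial⇒nonZero; nonTrivial⇒n>1)
open import Data.Nat.Properties
open import Data.Nat.Divisibility
open import Data.Nat.GCD using (gcd; gcd[m,n]∣m; gcd[m,n]∣n; gcd-greatest; c*gcd[m,n]≡gcd[cm,cn])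
open import Data.Nat.Coprimality as Coprime using (Coprime; coprime?; coprime-divisor; 1-coprimeTo)
open import Data.Nat.Primality using (Prime; prime⇒irreducible; prime⇒nonZero; prime⇒nonTrivial; ¬prime[1])
open import Data.Nat.ListAction using (sum)
open import Data.Nat.Solver using (module +-*-Solver)
open import Data.Nat.ListAction.Properties using (sum-++; sum-↭)
open import Data.List using (List; []; _∷_; _++_; map; length; filterᵇ; foldr; cartesianProduct; upTo; applyUpTo)
open import Data.List.Properties
  using (map-++; map-∘; map-cong-local; length-map; length-++; length-upTo; length-applyUpTo; filter-accept; filter-all)
open import Data.List.Membership.Propositional using (_∈_)
open import Data.List.Membership.Propositional.Properties
  using (∈-map⁺; ∈-map⁻; ∈-filter⁺; ∈-filter⁻; ∈-upTo⁺; ∈-upTo⁻; ∈-applyUpTo⁻;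
         ∈-cartesianProduct⁺; ∈-cartesianProduct⁻)
open import Data.List.Membership.Propositional.Properties.WithK using (unique∧set⇒bag)
open import Data.List.Relation.Binary.BagAndSetEquality using (∼bag⇒↭)
open import Data.List.Relation.Binary.Permutation.Propositional using (_↭_)
import Data.List.Relation.Binary.Permutation.Propositional.Properties as ↭
open import Data.List.Relation.Unary.All as All using (All; []; _∷_)
open import Data.List.Relation.Unary.All.Properties using () renaming (map⁺ to All-map⁺)
open import Data.List.Relation.Unary.Any using (here; there)
open import Data.List.Relation.Unary.Unique.Propositional using (Unique; []; _∷_)
import Data.List.Relation.Unary.Unique.Propositional.Properties as Unique
open import Data.Product using (_×_; _,_; proj₁; proj₂; ∃; uncurry)
open import Data.Sum using (inj₁; inj₂)
open import Function using (_∘_; _⇔_; mk⇔; Equivalence)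
open import Relation.Binary.Definitions using (tri<; tri≈; tri>)
open import Relation.Binary.PropositionalEquality
open import Relation.Unary using (Decidable)
open import Relation.Nullary using (¬_; Dec; yes; no; does; contradiction)
open import Relation.Nullary.Decidable using (dec-true; dec-false; does-≡; map′; _×-dec_)

open +-*-Solver

𝟙 : Bool → ℕ
𝟙 b = if b then 1 else 0

𝟙-∧ : ∀ x y → 𝟙 (x ∧ y) ≡ 𝟙 x * 𝟙 y
𝟙-∧ false y = refl
𝟙-∧ true  y = sym (+-identityʳ (𝟙 y))

sum-map-cong : ∀ {A : Set} {f g : A → ℕ} (xs : List A) →
  (∀ {x} → x ∈ xs → f x ≡ g x) → sum (map f xs) ≡ sum (map g xs)
sum-map-cong xs f≡g = cong sum (map-cong-local (All.tabulate f≡g))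

sum-map-const : ∀ {A : Set} c (xs : List A) → sum (map (λ _ → c) xs) ≡ length xs * c
sum-map-const c []       = refl
sum-map-const c (x ∷ xs) = cong (c +_) (sum-map-const c xs)

sum-map-*ˡ : ∀ {A : Set} c (f : A → ℕ) xs → sum (map (λ x → c * f x) xs) ≡ c * sum (map f xs)
sum-map-*ˡ c f []       = sym (*-zeroʳ c)
sum-map-*ˡ c f (x ∷ xs) = trans (cong (c * f x +_) (sum-map-*ˡ c f xs)) (sym (*-distribˡ-+ c (f x) _))

sum-map-↭ : ∀ {A : Set} (f : A → ℕ) {xs ys} → xs ↭ ys → sum (map f xs) ≡ sum (map f ys)
sum-map-↭ f = sum-↭ ∘ ↭.map⁺ f

sum-map-cartesianProduct : ∀ {A B : Set} (h : A × B → ℕ) (f : A → ℕ) (g : B → ℕ) xs ys →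
  (∀ {x y} → x ∈ xs → y ∈ ys → h (x , y) ≡ f x * g y) →
  sum (map h (cartesianProduct xs ys)) ≡ sum (map f xs) * sum (map g ys)
sum-map-cartesianProduct h f g []       ys h≡ = refl
sum-map-cartesianProduct h f g (x ∷ xs) ys h≡ = begin
  sum (map h (map (x ,_) ys ++ cartesianProduct xs ys))
    ≡⟨ cong sum (map-++ h (map (x ,_) ys) _) ⟩
  sum (map h (map (x ,_) ys) ++ map h (cartesianProduct xs ys))
    ≡⟨ sum-++ (map h (map (x ,_) ys)) _ ⟩
  sum (map h (map (x ,_) ys)) + sum (map h (cartesianProduct xs ys))
    ≡⟨ cong₂ _+_ row (sum-map-cartesianProduct h f g xs ys (h≡ ∘ there)) ⟩
  f x * sum (map g ys) + sum (map f xs) * sum (map g ys)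
    ≡⟨ *-distribʳ-+ (sum (map g ys)) (f x) _ ⟨
  sum (map f (x ∷ xs)) * sum (map g ys) ∎
  where
  open ≡-Reasoning
  row : sum (map h (map (x ,_) ys)) ≡ f x * sum (map g ys)
  row = begin
    sum (map h (map (x ,_) ys))  ≡⟨ cong sum (map-∘ ys) ⟨
    sum (map (h ∘ (x ,_)) ys)    ≡⟨ sum-map-cong ys (h≡ (here refl)) ⟩
    sum (map (λ y → f x * g y) ys) ≡⟨ sum-map-*ˡ (f x) g ys ⟩
    f x * sum (map g ys) ∎

length-cartesianProduct : ∀ {A B : Set} (xs : List A) (ys : List B) →
  length (cartesianProduct xs ys) ≡ length xs * length ys
length-cartesianProduct []       ys = refl
length-cartesianProduct (x ∷ xs) ys = begin
  length (map (x ,_) ys ++ cartesianProduct xs ys)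
    ≡⟨ length-++ (map (x ,_) ys) ⟩
  length (map (x ,_) ys) + length (cartesianProduct xs ys)
    ≡⟨ cong₂ _+_ (length-map (x ,_) ys) (length-cartesianProduct xs ys) ⟩
  length ys + length xs * length ys ∎
  where open ≡-Reasoning

length-filterᵇ : ∀ {A : Set} (p : A → Bool) xs → length (filterᵇ p xs) ≡ sum (map (𝟙 ∘ p) xs)
length-filterᵇ p []       = refl
length-filterᵇ p (x ∷ xs) with p x
... | true  = cong suc (length-filterᵇ p xs)
... | false = length-filterᵇ p xs

foldr-⊔-≤ : ∀ {c} xs → All (_≤ c) xs → foldr _⊔_ 0 xs ≤ c
foldr-⊔-≤ []       []            = z≤n
foldr-⊔-≤ (x ∷ xs) (x≤c ∷ xs≤c) = ⊔-lub x≤c (foldr-⊔-≤ xs xs≤c)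

foldr-⊔-≡ : ∀ {c} xs → All (_≤ c) xs → c ∈ xs → foldr _⊔_ 0 xs ≡ c
foldr-⊔-≡ (x ∷ xs) (_ ∷ xs≤c)   (here refl) = m≥n⇒m⊔n≡m (foldr-⊔-≤ xs xs≤c)
foldr-⊔-≡ (x ∷ xs) (x≤c ∷ xs≤c) (there c∈) =
  trans (cong (x ⊔_) (foldr-⊔-≡ xs xs≤c c∈)) (m≤n⇒m⊔n≡n x≤c)

Unique-map⁺-local : ∀ {A B : Set} {f : A → B} {xs} →
  (∀ {x y} → x ∈ xs → y ∈ xs → f x ≡ f y → x ≡ y) → Unique xs → Unique (map f xs)
Unique-map⁺-local inj []            = []
Unique-map⁺-local inj (x∉xs ∷ uxs) =
  All-map⁺ (All.tabulate λ y∈ fx≡fy → All.lookup x∉xs y∈ (inj (here refl) (there y∈) fx≡fy))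
  ∷ Unique-map⁺-local (λ x∈ y∈ → inj (there x∈) (there y∈)) uxs

unique∧set⇒↭ : ∀ {A : Set} {xs ys : List A} →
  Unique xs → Unique ys → (∀ {z} → z ∈ xs ⇔ z ∈ ys) → xs ↭ ys
unique∧set⇒↭ uxs uys xs≈ys = ∼bag⇒↭ (unique∧set⇒bag uxs uys xs≈ys)

any-≡true : ∀ {A : Set} (f : A → Bool) {x xs} → x ∈ xs → f x ≡ true → any f xs ≡ true
any-≡true f {xs = y ∷ ys} (here refl) fx≡true = cong (_∨ any f ys) fx≡true
any-≡true f {xs = y ∷ ys} (there x∈)  fx≡true =
  trans (cong (f y ∨_) (any-≡true f x∈ fx≡true)) (∨-zeroʳ (f y))

any-≡false : ∀ {A : Set} (f : A → Bool) xs → (∀ x → f x ≡ false) → any f xs ≡ false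
any-≡false f []       _      = refl
any-≡false f (y ∷ ys) f≡false = cong₂ _∨_ (f≡false y) (any-≡false f ys f≡false)

Unique-∃≢ : ∀ {xs : List ℕ} z → Unique xs → 2 ≤ length xs → ∃ λ x → x ∈ xs × x ≢ z
Unique-∃≢ {x ∷ []}    z _                 (s≤s ())
Unique-∃≢ {x ∷ y ∷ _} z ((x≢y ∷ _) ∷ _) _ with x ≟ z
... | no x≢z   = x , here refl , x≢z
... | yes refl = y , there (here refl) , x≢y ∘ sym

-- Divisors and coprimality

T-does⇔ : ∀ {A : Set} (a? : Dec A) → T (does a?) ⇔ A
T-does⇔ (yes a) = mk⇔ (λ _ → a) _
T-does⇔ (no ¬a) = mk⇔ (λ ()) ¬a

isDivisor? : ∀ n → Decidable (λ d → T (does (d ∣? n)))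
isDivisor? n d = T? (does (d ∣? n))

∈-divisors⁻ : ∀ n {d} → d ∈ divisors n → d ∣ n
∈-divisors⁻ n {d} d∈ =
  Equivalence.to (T-does⇔ (d ∣? n)) (proj₂ (∈-filter⁻ (isDivisor? n) {xs = map suc (upTo n)} d∈))

∈-divisors⁺ : ∀ {n d} .{{_ : NonZero n}} → d ∣ n → d ∈ divisors n
∈-divisors⁺ {n} {zero}  0∣n = contradiction (0∣⇒≡0 0∣n) (≢-nonZero⁻¹ n)
∈-divisors⁺ {n} {suc d} d∣n =
  ∈-filter⁺ (isDivisor? n) (∈-map⁺ suc (∈-upTo⁺ (∣⇒≤ d∣n))) (Equivalence.from (T-does⇔ (suc d ∣? n)) d∣n)

divisors-unique : ∀ n → Unique (divisors n)
divisors-unique n = Unique.filter⁺ (isDivisor? n) (Unique.map⁺ suc-injective (Unique.upTo⁺ n))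

divisors-head : ∀ n .{{_ : NonZero n}} → ∃ λ ds → divisors n ≡ 1 ∷ ds
divisors-head (suc m) = _ , filter-accept (isDivisor? (suc m)) (Equivalence.from (T-does⇔ (1 ∣? suc m)) (1∣ suc m))

numDivisors : ℕ → ℕ
numDivisors n = length (divisors n)

divisorSum : ℕ → (ℕ → ℕ) → ℕ
divisorSum n f = sum (map f (divisors n))

coprime-∣ : ∀ {a b x y} → Coprime a b → x ∣ a → y ∣ b → Coprime x y
coprime-∣ a⊥b x∣a y∣b (d∣x , d∣y) = a⊥b (∣-trans d∣x x∣a , ∣-trans d∣y y∣b)

coprime-*ʳ : ∀ {a b c} → Coprime a b → Coprime a c → Coprime a (b * c)
coprime-*ʳ a⊥b a⊥c (d∣a , d∣bc) = a⊥c (d∣a , coprime-divisor (coprime-∣ a⊥b d∣a ∣-refl) d∣bc)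

coprime-*ˡ : ∀ {a b c} → Coprime a c → Coprime b c → Coprime (a * b) c
coprime-*ˡ a⊥c b⊥c = Coprime.sym (coprime-*ʳ (Coprime.sym a⊥c) (Coprime.sym b⊥c))

coprime-^ˡ : ∀ {a b} k → Coprime a b → Coprime (a ^ k) b
coprime-^ˡ {b = b} zero    _   = 1-coprimeTo b
coprime-^ˡ         (suc k) a⊥b = coprime-*ˡ a⊥b (coprime-^ˡ k a⊥b)

∣⇒¬coprime : ∀ {d m} → d ∣ m → d ≢ 1 → ¬ Coprime d m
∣⇒¬coprime d∣m d≢1 d⊥m = d≢1 (d⊥m (∣-refl , d∣m))

prime≢⇒coprime : ∀ {p q} → Prime p → Prime q → p ≢ q → Coprime p q
prime≢⇒coprime {p} {q} p-prime q-prime p≢q (d∣p , d∣q) with prime⇒irreducible p-prime d∣p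
... | inj₁ d≡1 = d≡1
... | inj₂ refl with prime⇒irreducible q-prime d∣q
...   | inj₁ refl = contradiction p-prime ¬prime[1]
...   | inj₂ refl = contradiction refl p≢q

coprime⇒*∣ : ∀ {x y m} → Coprime x y → x ∣ m → y ∣ m → x * y ∣ m
coprime⇒*∣ {x} {y} x⊥y (divides q refl) y∣qx =
  subst (x * y ∣_) (*-comm x q) (*-monoʳ-∣ x (coprime-divisor (Coprime.sym x⊥y) (subst (y ∣_) (*-comm q x) y∣qx)))

gcd[d*e,a]≡d : ∀ {a b d e} → Coprime a b → d ∣ a → e ∣ b → gcd (d * e) a ≡ d
gcd[d*e,a]≡d {a} {b} {d} {e} a⊥b d∣a e∣b = ∣-antisym g∣d (gcd-greatest (m∣m*n e) d∣a)
  where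
  g∣d : gcd (d * e) a ∣ d
  g∣d = coprime-divisor (coprime-∣ a⊥b (gcd[m,n]∣n (d * e) a) e∣b)
          (subst (gcd (d * e) a ∣_) (*-comm d e) (gcd[m,n]∣m (d * e) a))

gcd[f,a]*gcd[f,b]≡f : ∀ {a b f} → Coprime a b → f ∣ a * b → gcd f a * gcd f b ≡ f
gcd[f,a]*gcd[f,b]≡f {a} {b} {f} a⊥b f∣ab = ∣-antisym
  (coprime⇒*∣ (coprime-∣ a⊥b (gcd[m,n]∣n f a) (gcd[m,n]∣n f b)) (gcd[m,n]∣m f a) (gcd[m,n]∣m f b))
  (subst (f ∣_) (sym (c*gcd[m,n]≡gcd[cm,cn] (gcd f a) f b)) (gcd-greatest (n∣m*n (gcd f a)) f∣gcd[f,a]*b))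
  where
  f∣gcd[f,a]*b : f ∣ gcd f a * b
  f∣gcd[f,a]*b = subst (f ∣_) (trans (sym (c*gcd[m,n]≡gcd[cm,cn] b f a)) (*-comm b (gcd f a)))
                   (gcd-greatest (n∣m*n b) (subst (f ∣_) (*-comm a b) f∣ab))

-- Divisor sums over coprime products and prime powers

divisors-*-↭ : ∀ {a b} .{{_ : NonZero a}} .{{_ : NonZero b}} → Coprime a b →
  map (uncurry _*_) (cartesianProduct (divisors a) (divisors b)) ↭ divisors (a * b)
divisors-*-↭ {a} {b} a⊥b = unique∧set⇒↭
  (Unique-map⁺-local injective (Unique.cartesianProduct⁺ (divisors-unique a) (divisors-unique b)))
  (divisors-unique (a * b))
  (mk⇔ to from)
  where
  instance _ = m*n≢0 a b
  pairs : List (ℕ × ℕ)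
  pairs = cartesianProduct (divisors a) (divisors b)
  injective : ∀ {de d'e'} → de ∈ pairs → d'e' ∈ pairs → uncurry _*_ de ≡ uncurry _*_ d'e' → de ≡ d'e'
  injective {d , e} {d' , e'} de∈ d'e'∈ de≡d'e'
    with d∈ , e∈ ← ∈-cartesianProduct⁻ (divisors a) (divisors b) de∈
       | d'∈ , e'∈ ← ∈-cartesianProduct⁻ (divisors a) (divisors b) d'e'∈ = cong₂ _,_
    (begin
      d              ≡⟨ gcd[d*e,a]≡d a⊥b (∈-divisors⁻ a d∈) (∈-divisors⁻ b e∈) ⟨
      gcd (d * e) a   ≡⟨ cong (λ x → gcd x a) de≡d'e' ⟩
      gcd (d' * e') a ≡⟨ gcd[d*e,a]≡d a⊥b (∈-divisors⁻ a d'∈) (∈-divisors⁻ b e'∈) ⟩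
      d' ∎)
    (begin
      e               ≡⟨ gcd[d*e,a]≡d (Coprime.sym a⊥b) (∈-divisors⁻ b e∈) (∈-divisors⁻ a d∈) ⟨
      gcd (e * d) b   ≡⟨ cong (λ x → gcd x b) (trans (*-comm e d) (trans de≡d'e' (*-comm d' e'))) ⟩
      gcd (e' * d') b ≡⟨ gcd[d*e,a]≡d (Coprime.sym a⊥b) (∈-divisors⁻ b e'∈) (∈-divisors⁻ a d'∈) ⟩
      e' ∎)
    where open ≡-Reasoning
  to : ∀ {f} → f ∈ map (uncurry _*_) pairs → f ∈ divisors (a * b)
  to f∈ with (d , e) , de∈ , refl ← ∈-map⁻ (uncurry _*_) f∈ =
    let d∈ , e∈ = ∈-cartesianProduct⁻ (divisors a) (divisors b) de∈
    in ∈-divisors⁺ (*-pres-∣ (∈-divisors⁻ a d∈) (∈-divisors⁻ b e∈))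
  from : ∀ {f} → f ∈ divisors (a * b) → f ∈ map (uncurry _*_) pairs
  from {f} f∈ = subst (_∈ _) (gcd[f,a]*gcd[f,b]≡f a⊥b (∈-divisors⁻ (a * b) f∈))
    (∈-map⁺ (uncurry _*_)
      (∈-cartesianProduct⁺ (∈-divisors⁺ (gcd[m,n]∣n f a)) (∈-divisors⁺ (gcd[m,n]∣n f b))))

divisorSum-* : ∀ {a b} .{{_ : NonZero a}} .{{_ : NonZero b}} → Coprime a b → (F f g : ℕ → ℕ) →
  (∀ {d e} → d ∣ a → e ∣ b → F (d * e) ≡ f d * g e) →
  divisorSum (a * b) F ≡ divisorSum a f * divisorSum b g
divisorSum-* {a} {b} a⊥b F f g F≡ = begin
  sum (map F (divisors (a * b)))
    ≡⟨ sum-map-↭ F (divisors-*-↭ a⊥b) ⟨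
  sum (map F (map (uncurry _*_) (cartesianProduct (divisors a) (divisors b))))
    ≡⟨ cong sum (map-∘ (cartesianProduct (divisors a) (divisors b))) ⟨
  sum (map (F ∘ uncurry _*_) (cartesianProduct (divisors a) (divisors b)))
    ≡⟨ sum-map-cartesianProduct _ f g (divisors a) (divisors b)
         (λ d∈ e∈ → F≡ (∈-divisors⁻ a d∈) (∈-divisors⁻ b e∈)) ⟩
  divisorSum a f * divisorSum b g ∎
  where open ≡-Reasoning

^-injectiveʳ : ∀ {p} → 1 < p → ∀ {i j} → p ^ i ≡ p ^ j → i ≡ j
^-injectiveʳ {p} 1<p {i} {j} p^i≡p^j with <-cmp i j
... | tri< i<j _ _ = contradiction p^i≡p^j (<⇒≢ (^-monoʳ-< p 1<p i<j))
... | tri≈ _ i≡j _ = i≡j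
... | tri> _ _ j<i = contradiction (sym p^i≡p^j) (<⇒≢ (^-monoʳ-< p 1<p j<i))

^-monoʳ-∣ : ∀ p {i k} → i ≤ k → p ^ i ∣ p ^ k
^-monoʳ-∣ p {i} {k} i≤k = subst (p ^ i ∣_) p^i*p^[k∸i]≡p^k (m∣m*n (p ^ (k ∸ i)))
  where
  p^i*p^[k∸i]≡p^k : p ^ i * p ^ (k ∸ i) ≡ p ^ k
  p^i*p^[k∸i]≡p^k = trans (sym (^-distribˡ-+-* p i (k ∸ i))) (cong (p ^_) (m+[n∸m]≡n i≤k))

∣p^k⇒≡p^i : ∀ {p d} → Prime p → ∀ k → d ∣ p ^ k → ∃ λ i → i ≤ k × d ≡ p ^ i
∣p^k⇒≡p^i {p} {d} p-prime zero    d∣1 = 0 , z≤n , ∣1⇒≡1 d∣1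
∣p^k⇒≡p^i {p} {d} p-prime (suc k) d∣p^[1+k] with p ∣? d
... | yes (divides q refl) =
  let instance _ = prime⇒nonZero p-prime
      i , i≤k , q≡p^i = ∣p^k⇒≡p^i p-prime k (*-cancelˡ-∣ p (subst (_∣ p * p ^ k) (*-comm q p) d∣p^[1+k]))
  in suc i , s≤s i≤k , trans (*-comm q p) (cong (p *_) q≡p^i)
... | no p∤d =
  let i , i≤k , d≡p^i = ∣p^k⇒≡p^i p-prime k (coprime-divisor d⊥p d∣p^[1+k])
  in i , m≤n⇒m≤1+n i≤k , d≡p^i
  where
  d⊥p : Coprime d p
  d⊥p (c∣d , c∣p) with prime⇒irreducible p-prime c∣p
  ... | inj₁ c≡1 = c≡1
  ... | inj₂ refl = contradiction c∣d p∤d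

divisors-^-↭ : ∀ {p} → Prime p → ∀ k → map (p ^_) (upTo (suc k)) ↭ divisors (p ^ k)
divisors-^-↭ {p} p-prime k = unique∧set⇒↭
  (Unique.map⁺ (^-injectiveʳ (nonTrivial⇒n>1 p)) (Unique.upTo⁺ (suc k)))
  (divisors-unique (p ^ k))
  (mk⇔ to from)
  where
  instance
    _ = prime⇒nonTrivial p-prime
    _ = m^n≢0 p k {{nonTrivial⇒nonZero p}}
  to : ∀ {d} → d ∈ map (p ^_) (upTo (suc k)) → d ∈ divisors (p ^ k)
  to d∈ with i , i∈ , refl ← ∈-map⁻ (p ^_) d∈ = ∈-divisors⁺ (^-monoʳ-∣ p (s≤s⁻¹ (∈-upTo⁻ i∈)))
  from : ∀ {d} → d ∈ divisors (p ^ k) → d ∈ map (p ^_) (upTo (suc k))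
  from d∈ with i , i≤k , refl ← ∣p^k⇒≡p^i p-prime k (∈-divisors⁻ (p ^ k) d∈) =
    ∈-map⁺ (p ^_) (∈-upTo⁺ (s≤s i≤k))

divisorSum-^ : ∀ {p} → Prime p → ∀ k (f : ℕ → ℕ) →
  divisorSum (p ^ k) f ≡ sum (map (f ∘ (p ^_)) (upTo (suc k)))
divisorSum-^ {p} p-prime k f = begin
  sum (map f (divisors (p ^ k)))         ≡⟨ sum-map-↭ f (divisors-^-↭ p-prime k) ⟨
  sum (map f (map (p ^_) (upTo (suc k)))) ≡⟨ cong sum (map-∘ (upTo (suc k))) ⟨
  sum (map (f ∘ (p ^_)) (upTo (suc k))) ∎
  where open ≡-Reasoning

-- Counting divisors and coprime pairs

coprimeCount : ℕ → ℕ → ℕ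
coprimeCount n v = divisorSum n (λ u → 𝟙 (does (coprime? v u)))

coprimePairCount : ℕ → ℕ
coprimePairCount n = divisorSum n (coprimeCount n)

Multiplicative : (ℕ → ℕ) → Set
Multiplicative F = ∀ {a b} .{{_ : NonZero a}} .{{_ : NonZero b}} → Coprime a b → F (a * b) ≡ F a * F b

numDivisors-multiplicative : Multiplicative numDivisors
numDivisors-multiplicative {a} {b} a⊥b = begin
  length (divisors (a * b))
    ≡⟨ ↭.↭-length (divisors-*-↭ a⊥b) ⟨
  length (map (uncurry _*_) (cartesianProduct (divisors a) (divisors b)))
    ≡⟨ length-map (uncurry _*_) (cartesianProduct (divisors a) (divisors b)) ⟩
  length (cartesianProduct (divisors a) (divisors b))
    ≡⟨ length-cartesianProduct (divisors a) (divisors b) ⟩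
  length (divisors a) * length (divisors b) ∎
  where open ≡-Reasoning

numDivisors-^ : ∀ {p} → Prime p → ∀ k → numDivisors (p ^ k) ≡ suc k
numDivisors-^ {p} p-prime k = begin
  length (divisors (p ^ k))          ≡⟨ ↭.↭-length (divisors-^-↭ p-prime k) ⟨
  length (map (p ^_) (upTo (suc k))) ≡⟨ length-map (p ^_) (upTo (suc k)) ⟩
  length (upTo (suc k))              ≡⟨ length-upTo (suc k) ⟩
  suc k ∎
  where open ≡-Reasoning

coprime?-* : ∀ {a b d d' e e'} → Coprime a b → d ∣ a → d' ∣ a → e ∣ b → e' ∣ b →
  does (coprime? (d * e) (d' * e')) ≡ does (coprime? d d') ∧ does (coprime? e e')
coprime?-* {a} {b} {d} {d'} {e} {e'} a⊥b d∣a d'∣a e∣b e'∣b =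
  does-≡ (coprime? (d * e) (d' * e')) (map′ join split (coprime? d d' ×-dec coprime? e e'))
  where
  split : Coprime (d * e) (d' * e') → Coprime d d' × Coprime e e'
  split de⊥d'e' = coprime-∣ de⊥d'e' (m∣m*n e) (m∣m*n e') , coprime-∣ de⊥d'e' (n∣m*n d) (n∣m*n d')
  join : Coprime d d' × Coprime e e' → Coprime (d * e) (d' * e')
  join (d⊥d' , e⊥e') = coprime-*ˡ
    (coprime-*ʳ d⊥d' (coprime-∣ a⊥b d∣a e'∣b))
    (coprime-*ʳ (coprime-∣ (Coprime.sym a⊥b) e∣b d'∣a) e⊥e')

coprimePairCount-multiplicative : Multiplicative coprimePairCount
coprimePairCount-multiplicative {a} {b} a⊥b = divisorSum-* a⊥b _ _ _ coprimeCount-*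
  where
  instance _ = m*n≢0 a b
  coprimeCount-* : ∀ {d e} → d ∣ a → e ∣ b →
    coprimeCount (a * b) (d * e) ≡ coprimeCount a d * coprimeCount b e
  coprimeCount-* {d} {e} d∣a e∣b = divisorSum-* a⊥b _ _ _ λ {d'} {e'} d'∣a e'∣b →
    trans (cong 𝟙 (coprime?-* a⊥b d∣a d'∣a e∣b e'∣b)) (𝟙-∧ (does (coprime? d d')) (does (coprime? e e')))

𝟙-coprime? : ∀ {v u} → Coprime v u → 𝟙 (does (coprime? v u)) ≡ 1
𝟙-coprime? {v} {u} v⊥u = cong 𝟙 (dec-true (coprime? v u) v⊥u)

coprimeCount-1 : ∀ n → coprimeCount n 1 ≡ numDivisors n
coprimeCount-1 n = begin
  sum (map (λ u → 𝟙 (does (coprime? 1 u))) (divisors n))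
    ≡⟨ sum-map-cong (divisors n) (λ {u} _ → 𝟙-coprime? (1-coprimeTo u)) ⟩
  sum (map (λ _ → 1) (divisors n))
    ≡⟨ sum-map-const 1 (divisors n) ⟩
  length (divisors n) * 1
    ≡⟨ *-identityʳ _ ⟩
  length (divisors n) ∎
  where open ≡-Reasoning

coprimePairCount-^ : ∀ {p} → Prime p → ∀ k → coprimePairCount (p ^ k) ≡ suc (2 * k)
coprimePairCount-^ {p} p-prime k = begin
  coprimePairCount (p ^ k)
    ≡⟨ divisorSum-^ p-prime k (coprimeCount (p ^ k)) ⟩
  sum (map (coprimeCount (p ^ k) ∘ (p ^_)) (upTo (suc k)))
    ≡⟨ sum-map-cong (upTo (suc k)) (λ {i} _ → divisorSum-^ p-prime k (𝟙 ∘ does ∘ coprime? (p ^ i))) ⟩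
  sum (map row (upTo (suc k)))
    ≡⟨ cong₂ _+_ row₀ (sum-map-cong (applyUpTo suc k) rowₛ) ⟩
  suc k + sum (map (λ _ → 1) (applyUpTo suc k))
    ≡⟨ cong (suc k +_) (sum-map-const 1 (applyUpTo suc k)) ⟩
  suc k + length (applyUpTo suc k) * 1
    ≡⟨ cong (suc k +_) (trans (*-identityʳ _) (length-applyUpTo suc k)) ⟩
  suc k + k
    ≡⟨ cong suc (cong (k +_) (sym (+-identityʳ k))) ⟩
  suc (2 * k) ∎
  where
  open ≡-Reasoning
  row : ℕ → ℕ
  row i = sum (map (λ j → 𝟙 (does (coprime? (p ^ i) (p ^ j)))) (upTo (suc k)))
  row₀ : row 0 ≡ suc k
  row₀ = begin
    row 0                              ≡⟨ sum-map-cong (upTo (suc k)) (λ {j} _ → 𝟙-coprime? (1-coprimeTo (p ^ j))) ⟩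
    sum (map (λ _ → 1) (upTo (suc k))) ≡⟨ sum-map-const 1 (upTo (suc k)) ⟩
    length (upTo (suc k)) * 1        ≡⟨ *-identityʳ _ ⟩
    length (upTo (suc k))            ≡⟨ length-upTo (suc k) ⟩
    suc k ∎
  ¬coprime[p^[1+i],p^[1+j]] : ∀ i j → ¬ Coprime (p ^ suc i) (p ^ suc j)
  ¬coprime[p^[1+i],p^[1+j]] i j p^[1+i]⊥p^[1+j] =
    <⇒≢ (nonTrivial⇒n>1 p {{prime⇒nonTrivial p-prime}})
        (sym (p^[1+i]⊥p^[1+j] (m∣m*n (p ^ i) , m∣m*n (p ^ j))))
  rowₛ : ∀ {i} → i ∈ applyUpTo suc k → row i ≡ 1
  rowₛ i∈ with i , _ , refl ← ∈-applyUpTo⁻ suc i∈ = begin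
    row (suc i)
      ≡⟨ cong₂ _+_ (𝟙-coprime? (Coprime.sym (1-coprimeTo (p ^ suc i)))) (sum-map-cong (applyUpTo suc k) zero-entry) ⟩
    1 + sum (map (λ _ → 0) (applyUpTo suc k))
      ≡⟨ cong suc (sum-map-const 0 (applyUpTo suc k)) ⟩
    1 + length (applyUpTo suc k) * 0
      ≡⟨ cong suc (*-zeroʳ (length (applyUpTo suc k))) ⟩
    1 ∎
    where
    zero-entry : ∀ {j} → j ∈ applyUpTo suc k → 𝟙 (does (coprime? (p ^ suc i) (p ^ j))) ≡ 0
    zero-entry j∈ with j , _ , refl ← ∈-applyUpTo⁻ suc j∈ =
      cong 𝟙 (dec-false (coprime? _ _) (¬coprime[p^[1+i],p^[1+j]] i j))

factorValue≢0 : ∀ {fs} → All (λ pk → Prime (proj₁ pk)) fs → NonZero (factorValue fs)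
factorValue≢0 []                       = _
factorValue≢0 {(p , k) ∷ fs} (p-prime ∷ primes) =
  m*n≢0 (p ^ k) (factorValue fs) {{m^n≢0 p k {{prime⇒nonZero p-prime}}}} {{factorValue≢0 primes}}

coprime-factorValue : ∀ {p fs} → Prime p → All (λ pk → Prime (proj₁ pk)) fs → All (p ≢_) (map proj₁ fs) →
  Coprime p (factorValue fs)
coprime-factorValue {p} p-prime []                  []             = Coprime.sym (1-coprimeTo p)
coprime-factorValue {p} {(q , j) ∷ fs} p-prime (q-prime ∷ primes) (p≢q ∷ p∉fs) =
  coprime-*ʳ (Coprime.sym (coprime-^ˡ j (Coprime.sym (prime≢⇒coprime p-prime q-prime p≢q))))
             (coprime-factorValue p-prime primes p∉fs)

multiplicative-factorValue : ∀ F → Multiplicative F → F 1 ≡ 1 → (G : ℕ × ℕ → ℕ) →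
  (∀ {p} → Prime p → ∀ k → F (p ^ k) ≡ G (p , k)) →
  ∀ {fs} → All (λ pk → Prime (proj₁ pk)) fs → Unique (map proj₁ fs) →
  F (factorValue fs) ≡ foldr (λ pk r → G pk * r) 1 fs
multiplicative-factorValue F F-mult F1≡1 G F-^ []                 []             = F1≡1
multiplicative-factorValue F F-mult F1≡1 G F-^ {(p , k) ∷ fs} (p-prime ∷ primes) (p∉fs ∷ distinct) =
  begin
  F (p ^ k * factorValue fs)
    ≡⟨ F-mult p^k⊥rest ⟩
  F (p ^ k) * F (factorValue fs)
    ≡⟨ cong₂ _*_ (F-^ p-prime k) (multiplicative-factorValue F F-mult F1≡1 G F-^ primes distinct) ⟩
  G (p , k) * foldr (λ pk r → G pk * r) 1 fs ∎
  where
  open ≡-Reasoning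
  instance
    _ = m^n≢0 p k {{prime⇒nonZero p-prime}}
    _ = factorValue≢0 primes
  p^k⊥rest : Coprime (p ^ k) (factorValue fs)
  p^k⊥rest = coprime-^ˡ k (coprime-factorValue p-prime primes p∉fs)

-- The divisor prime graph

adj-irrefl : ∀ u → adj u u ≡ false
adj-irrefl u = cong (λ b → not b ∧ does (coprime? u u)) (dec-true (u ≟ u) refl)

adj⇒≢ : ∀ {u v} → adj u v ≡ true → u ≢ v
adj⇒≢ {u} uv refl = contradiction (trans (sym uv) (adj-irrefl u)) λ ()

adj-1ˡ : ∀ {u} → u ≢ 1 → adj 1 u ≡ true
adj-1ˡ {u} u≢1 =
  cong₂ (λ b c → not b ∧ c) (dec-false (1 ≟ u) (u≢1 ∘ sym)) (dec-true (coprime? 1 u) (1-coprimeTo u))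

adj-1ʳ : ∀ {u} → u ≢ 1 → adj u 1 ≡ true
adj-1ʳ {u} u≢1 =
  cong₂ (λ b c → not b ∧ c) (dec-false (u ≟ 1) u≢1) (dec-true (coprime? u 1) (Coprime.sym (1-coprimeTo u)))

adj-¬coprime : ∀ {u v} → ¬ Coprime u v → adj u v ≡ false
adj-¬coprime {u} {v} ¬u⊥v = trans (cong (not (does (u ≟ v)) ∧_) (dec-false (coprime? u v) ¬u⊥v)) (∧-zeroʳ _)

-- Away from the vertex 1 the loop condition is automatic, since gcd v v = v.  The case split is on
-- a Dec argument because `with v ≟ u` would also abstract the ≟ inside the unfolded gcd.
adj≡coprime? : ∀ {v u} → v ≢ 1 → adj v u ≡ does (coprime? v u)
adj≡coprime? {v} {u} v≢1 = by-cases (v ≟ u)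
  where
  by-cases : Dec (v ≡ u) → adj v u ≡ does (coprime? v u)
  by-cases (yes refl) = trans (adj-irrefl v) (sym (dec-false (coprime? v v) (∣⇒¬coprime ∣-refl v≢1)))
  by-cases (no v≢u)   = cong (λ b → not b ∧ does (coprime? v u)) (dec-false (v ≟ u) v≢u)

deg≡coprimeCount : ∀ n {v} → v ≢ 1 → deg n v ≡ coprimeCount n v
deg≡coprimeCount n {v} v≢1 =
  trans (length-filterᵇ (adj v) (divisors n)) (sum-map-cong (divisors n) (λ _ → cong 𝟙 (adj≡coprime? v≢1)))

m+2n≡2[1+m+n]∸[1+m]∸1 : ∀ m n → m + 2 * n ≡ 2 * (suc m + n) ∸ suc m ∸ 1
m+2n≡2[1+m+n]∸[1+m]∸1 m n = sym (begin
  2 * (suc m + n) ∸ suc m ∸ 1         ≡⟨ cong (λ x → x ∸ suc m ∸ 1) (expand m n) ⟩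
  suc m + suc (m + 2 * n) ∸ suc m ∸ 1 ≡⟨ cong (_∸ 1) (m+n∸m≡n (suc m) _) ⟩
  m + 2 * n ∎)
  where
  open ≡-Reasoning
  expand : ∀ m n → 2 * (suc m + n) ≡ suc m + suc (m + 2 * n)
  expand = solve 2 (λ m n → con 2 :* (con 1 :+ m :+ n) := (con 1 :+ m) :+ (con 1 :+ (m :+ con 2 :* n))) refl

module DivisorPrimeGraph (n : ℕ) where

  walk₁ : ∀ {u v} → v ∈ divisors n → adj u v ≡ true → walk n 1 u v ≡ true
  walk₁ {u} {v} v∈ uv =
    any-≡true (λ w → adj u w ∧ walk n 0 w v) v∈ (cong₂ _∧_ uv (dec-true (v ≟ v) refl))

  walk₁-false : ∀ {u v} → adj u v ≡ false → walk n 1 u v ≡ false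
  walk₁-false {u} {v} uv = any-≡false (λ w → adj u w ∧ walk n 0 w v) (divisors n) no-last-step
    where
    no-last-step : ∀ w → (adj u w ∧ does (w ≟ v)) ≡ false
    no-last-step w = by-cases (w ≟ v)
      where
      by-cases : Dec (w ≡ v) → (adj u w ∧ does (w ≟ v)) ≡ false
      by-cases (yes refl) = cong₂ _∧_ uv (dec-true (w ≟ w) refl)
      by-cases (no w≢v)   = trans (cong (adj u w ∧_) (dec-false (w ≟ v) w≢v)) (∧-zeroʳ (adj u w))

  walk₂ : ∀ {u w v} → w ∈ divisors n → adj u w ≡ true → v ∈ divisors n → adj w v ≡ true →
    walk n 2 u v ≡ true
  walk₂ {u} {w} {v} w∈ uw v∈ wv =
    any-≡true (λ x → adj u x ∧ walk n 1 x v) w∈ (cong₂ _∧_ uw (walk₁ {w} {v} v∈ wv))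

  -- With at least three vertices the search in dist reaches walks of length 2.
  dist≡0 : ∀ {u v} → 3 ≤ numDivisors n → walk n 0 u v ≡ true → dist n u v ≡ 0
  dist≡0 3≤τ w₀ with length (divisors n) | 3≤τ
  ... | _ | s≤s (s≤s (s≤s _)) rewrite w₀ = refl

  dist≡1 : ∀ {u v} → 3 ≤ numDivisors n → walk n 0 u v ≡ false → walk n 1 u v ≡ true → dist n u v ≡ 1
  dist≡1 3≤τ w₀ w₁ with length (divisors n) | 3≤τ
  ... | _ | s≤s (s≤s (s≤s _)) rewrite w₀ | w₁ = refl

  dist≡2 : ∀ {u v} → 3 ≤ numDivisors n →
    walk n 0 u v ≡ false → walk n 1 u v ≡ false → walk n 2 u v ≡ true → dist n u v ≡ 2
  dist≡2 3≤τ w₀ w₁ w₂ with length (divisors n) | 3≤τ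
  ... | _ | s≤s (s≤s (s≤s _)) rewrite w₀ | w₁ | w₂ = refl

  dist-adj : ∀ {u v} → 3 ≤ numDivisors n → v ∈ divisors n → adj u v ≡ true → dist n u v ≡ 1
  dist-adj {u} {v} 3≤τ v∈ uv = dist≡1 3≤τ (dec-false (u ≟ v) (adj⇒≢ {u} {v} uv)) (walk₁ {u} {v} v∈ uv)

  dist-nonadj : ∀ {u v} → 3 ≤ numDivisors n → u ≢ v → adj u v ≡ false →
    ∀ {w} → w ∈ divisors n → adj u w ≡ true → v ∈ divisors n → adj w v ≡ true → dist n u v ≡ 2
  dist-nonadj {u} {v} 3≤τ u≢v uv {w} w∈ uw v∈ wv =
    dist≡2 3≤τ (dec-false (u ≟ v) u≢v) (walk₁-false {u} {v} uv) (walk₂ {u} {w} {v} w∈ uw v∈ wv)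

  dist-self : 3 ≤ numDivisors n → ∀ u → dist n u u ≡ 0
  dist-self 3≤τ u = dist≡0 {u} {u} 3≤τ (dec-true (u ≟ u) refl)

  ecc≡ : ∀ {v c w} → (∀ {x} → x ∈ divisors n → dist n v x ≤ c) → w ∈ divisors n → dist n v w ≡ c →
    ecc n v ≡ c
  ecc≡ {v} dist≤c w∈ dist≡c = foldr-⊔-≡ (map (dist n v) (divisors n))
    (All-map⁺ (All.tabulate dist≤c)) (subst (_∈ _) dist≡c (∈-map⁺ (dist n v) w∈))

  module _ .{{_ : NonZero n}} (3≤τ : 3 ≤ numDivisors n) where

    private
      ds : List ℕ
      ds = proj₁ (divisors-head n)

      V≡1∷ds : divisors n ≡ 1 ∷ ds
      V≡1∷ds = proj₂ (divisors-head n)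

    1∈V : 1 ∈ divisors n
    1∈V = ∈-divisors⁺ (1∣ n)

    n∈V : n ∈ divisors n
    n∈V = ∈-divisors⁺ ∣-refl

    ∈ds⇒∈V∧≢1 : ∀ {w} → w ∈ ds → w ∈ divisors n × w ≢ 1
    ∈ds⇒∈V∧≢1 {w} w∈ds with subst Unique V≡1∷ds (divisors-unique n)
    ... | 1∉ds ∷ _ = subst (w ∈_) (sym V≡1∷ds) (there w∈ds) , All.lookup 1∉ds w∈ds ∘ sym

    n≢1 : n ≢ 1
    n≢1 n≡1 = <⇒≱ (s≤s (s≤s z≤n)) (subst (λ m → 3 ≤ numDivisors m) n≡1 3≤τ)

    ∃-divisor≢1,n : ∃ λ w → w ∈ divisors n × w ≢ 1 × w ≢ n
    ∃-divisor≢1,n =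
      let w , w∈ds , w≢n = Unique-∃≢ n (Unique.drop⁺ 1 (subst Unique V≡1∷ds (divisors-unique n))) 2≤|ds|
          w∈V , w≢1       = ∈ds⇒∈V∧≢1 w∈ds
      in w , w∈V , w≢1 , w≢n
      where
      2≤|ds| : 2 ≤ length ds
      2≤|ds| = s≤s⁻¹ (subst (3 ≤_) (cong length V≡1∷ds) 3≤τ)

    dist-≤2 : ∀ {u x} → u ≢ 1 → x ∈ divisors n → dist n u x ≤ 2
    dist-≤2 {u} {x} u≢1 x∈ = by-cases (u ≟ x) (adj u x) refl
      where
      by-cases : Dec (u ≡ x) → ∀ b → adj u x ≡ b → dist n u x ≤ 2
      by-cases (yes refl) _     _  = subst (_≤ 2) (sym (dist-self 3≤τ u)) z≤n
      by-cases (no _)     true  ux = subst (_≤ 2) (sym (dist-adj 3≤τ x∈ ux)) (s≤s z≤n)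
      by-cases (no u≢x)   false ux = ≤-reflexive (dist-nonadj 3≤τ u≢x ux 1∈V (adj-1ʳ u≢1) x∈ (adj-1ˡ x≢1))
        where
        x≢1 : x ≢ 1
        x≢1 refl = contradiction (trans (sym ux) (adj-1ʳ u≢1)) λ ()

    ecc-1 : ecc n 1 ≡ 1
    ecc-1 = ecc≡ dist-1-≤1 n∈V (dist-adj 3≤τ n∈V (adj-1ˡ n≢1))
      where
      dist-1-≤1 : ∀ {x} → x ∈ divisors n → dist n 1 x ≤ 1
      dist-1-≤1 {x} x∈ with x ≟ 1
      ... | yes refl = subst (_≤ 1) (sym (dist-self 3≤τ 1)) z≤n
      ... | no x≢1   = ≤-reflexive (dist-adj 3≤τ x∈ (adj-1ˡ x≢1))

    ecc-≢1 : ∀ {v} → v ∈ divisors n → v ≢ 1 → ecc n v ≡ 2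
    ecc-≢1 {v} v∈ v≢1 =
      let w , w∈ , w≢1 , w≢v , ¬v⊥w = nonNeighbour
      in ecc≡ (dist-≤2 v≢1) w∈
           (dist-nonadj 3≤τ (w≢v ∘ sym) (adj-¬coprime ¬v⊥w) 1∈V (adj-1ʳ v≢1) w∈ (adj-1ˡ w≢1))
      where
      nonNeighbour : ∃ λ w → w ∈ divisors n × w ≢ 1 × w ≢ v × ¬ Coprime v w
      nonNeighbour with v ≟ n
      ... | no v≢n   = n , n∈V , n≢1 , v≢n ∘ sym , ∣⇒¬coprime (∈-divisors⁻ n v∈) v≢1
      ... | yes refl = let w , w∈ , w≢1 , w≢n = ∃-divisor≢1,n
                       in w , w∈ , w≢1 , w≢n , ∣⇒¬coprime (∈-divisors⁻ n w∈) w≢1 ∘ Coprime.sym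

    ξc≡ : ξc n ≡ 2 * coprimePairCount n ∸ numDivisors n ∸ 1
    ξc≡ = begin
      ξc n
        ≡⟨ cong (sum ∘ map (λ v → deg n v * ecc n v)) V≡1∷ds ⟩
      deg n 1 * ecc n 1 + sum (map (λ v → deg n v * ecc n v) ds)
        ≡⟨ cong₂ _+_ (cong₂ _*_ deg-1 ecc-1) (sum-map-cong ds term) ⟩
      length ds * 1 + sum (map (λ v → 2 * coprimeCount n v) ds)
        ≡⟨ cong₂ _+_ (*-identityʳ (length ds)) (sum-map-*ˡ 2 (coprimeCount n) ds) ⟩
      length ds + 2 * X
        ≡⟨ m+2n≡2[1+m+n]∸[1+m]∸1 (length ds) X ⟩
      2 * (suc (length ds) + X) ∸ suc (length ds) ∸ 1
        ≡⟨ cong₂ (λ P D → 2 * P ∸ D ∸ 1) P≡ τ≡ ⟨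
      2 * coprimePairCount n ∸ numDivisors n ∸ 1 ∎
      where
      open ≡-Reasoning
      X : ℕ
      X = sum (map (coprimeCount n) ds)
      τ≡ : numDivisors n ≡ suc (length ds)
      τ≡ = cong length V≡1∷ds
      P≡ : coprimePairCount n ≡ suc (length ds) + X
      P≡ = trans (cong (sum ∘ map (coprimeCount n)) V≡1∷ds) (cong (_+ X) (trans (coprimeCount-1 n) τ≡))
      deg-1 : deg n 1 ≡ length ds
      deg-1 = cong length (trans (cong (filterᵇ (adj 1)) V≡1∷ds)
        (filter-all (T? ∘ adj 1) (All.tabulate λ w∈ →
          Equivalence.from T-≡ (adj-1ˡ (proj₂ (∈ds⇒∈V∧≢1 w∈))))))
      term : ∀ {v} → v ∈ ds → deg n v * ecc n v ≡ 2 * coprimeCount n v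
      term {v} v∈ = let v∈V , v≢1 = ∈ds⇒∈V∧≢1 v∈ in
        trans (cong₂ _*_ (deg≡coprimeCount n v≢1) (ecc-≢1 v∈V v≢1)) (*-comm (coprimeCount n v) 2)

theorem3p7 : (n : ℕ) (fs : List (ℕ × ℕ)) →
    1 ≤ n →
    All (λ pk → Prime (proj₁ pk)) fs →
    Unique (map proj₁ fs) →
    All (λ pk → 1 ≤ proj₂ pk) fs →
    factorValue fs ≡ n →
    ¬ Prime n →
    3 ≤ divisorCount fs →
    ξc n ≡ 2 * prodTwoKPlusOne fs ∸ divisorCount fs ∸ 1
theorem3p7 .(factorValue fs) fs 1≤n primes distinct _ refl _ 3≤D = begin
  ξc n                                          ≡⟨ DivisorPrimeGraph.ξc≡ n {{>-nonZero 1≤n}} 3≤τ ⟩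
  2 * coprimePairCount n ∸ numDivisors n ∸ 1    ≡⟨ cong₂ (λ P D → 2 * P ∸ D ∸ 1) P≡ τ≡D ⟩
  2 * prodTwoKPlusOne fs ∸ divisorCount fs ∸ 1 ∎
  where
  open ≡-Reasoning
  n = factorValue fs
  τ≡D : numDivisors n ≡ divisorCount fs
  τ≡D = multiplicative-factorValue numDivisors numDivisors-multiplicative refl
          (suc ∘ proj₂) numDivisors-^ primes distinct
  P≡ : coprimePairCount n ≡ prodTwoKPlusOne fs
  P≡ = multiplicative-factorValue coprimePairCount coprimePairCount-multiplicative refl
         (λ (_ , k) → suc (2 * k)) coprimePairCount-^ primes distinct
  3≤τ : 3 ≤ numDivisors n
  3≤τ = subst (3 ≤_) (sym τ≡D) 3≤D
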